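{- Let $(a_1,\dots,a_n)$ and $(b_1,\dots,b_k)$ be finite non-increasing sequences of positive integers with $(a_1,\dots,a_n)\succ(b_1,\dots,b_k)$. Then $a_1!\,a_2!\cdots a_n!\ \ge\ b_1!\,b_2!\cdots b_k!$. Moreover, equality holds if and only if $n=k$ and $a_j=b_j$ for all $j$.
   Context: Majorization: for finite non-increasing sequences of positive integers $(a_1,\dots,a_n)$ and $(b_1,\dots,b_k)$, write $(a_1,\dots,a_n)\succ(b_1,\dots,b_k)$ if all of the following hold: (1) $n\le k$; (2) for every $i\le n$, $a_1+\dots+a_i\ge b_1+\dots+b_i$; (3) $a_1+\dots+a_n\ge b_1+\dots+b_k$. -}

module Defs where

open import Data.Nat using (ℕ; _≤_; _≥_; _<_; _!)
open import Data.List using (List; length; take; map)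
open import Data.Nat.ListAction using (sum; product)
open import Data.List.Relation.Unary.All using (All)
open import Data.List.Relation.Unary.Linked using (Linked)
open import Data.Product using (_×_)

NonIncreasing : List ℕ → Set
NonIncreasing = Linked _≥_

Positive : List ℕ → Set
Positive = All (0 <_)

_≻_ : List ℕ → List ℕ → Set
a ≻ b = (length a ≤ length b)
      × (∀ i → i ≤ length a → sum (take i a) ≥ sum (take i b))
      × (sum a ≥ sum b)

factProd : List ℕ → ℕ
factProd a = product (map (λ x → x !) a)

-- Let m be the first (largest) part of b and a₁ = m + d.  Moving the excess d onto the first
-- later entry y ≤ m of a (or appending it) keeps b with m removed weakly majorized: each new
-- prefix sum either gained d or consists of entries ≥ m.  Since y ≤ m, the rising product
-- (y+1)⋯(y+d) is at most (m+1)⋯(m+d), so the product of factorials does not grow, and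
-- induction on b gives the inequality (a need not stay sorted).  For equality: if a₁ > m,
-- this step is strict (some y < m gains d, or nothing follows a₁ and m ≥ 1, or the new list
-- starts above m and the recursion is strict), so a₁ = m and the first entries cancel.
module Submission where

open import Defs
open import Data.Nat using (ℕ; _≥_)
open import Data.List using (List)
open import Data.Product using (_×_)
open import Function.Bundles using (_⇔_)
open import Relation.Binary.PropositionalEquality using (_≡_)

open import Data.Nat using (zero; suc; _+_; _*_; _≤_; _<_; z≤n; s≤s; _!; _≤?_; NonZero; >-nonZero; z<s)
open import Data.Nat.Properties
open import Data.Nat.ListAction using (sum)
open import Algebra.Properties.CommutativeSemigroup +-commutativeSemigroup
  using () renaming (x∙yz≈y∙xz to x+[y+z]≡y+[x+z]; x∙yz≈yx∙z to x+[y+z]≡[y+x]+z)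
open import Algebra.Properties.CommutativeSemigroup *-commutativeSemigroup
  using () renaming (x∙yz≈y∙xz to x*[y*z]≡y*[x*z])
open import Data.List using ([]; _∷_; take; length)
open import Data.List.Properties using (take-[]; take-all)
open import Data.List.Relation.Unary.All using (All; []; _∷_)
import Data.List.Relation.Unary.AllPairs as AllPairs
import Data.List.Relation.Unary.Linked as Linked
open import Data.List.Relation.Unary.Linked.Properties using (Linked⇒AllPairs)
open import Data.Product using (_,_; ∃)
open import Data.Sum using (_⊎_; inj₁; inj₂)
open import Function.Bundles using (mk⇔)
open import Relation.Nullary using (yes; no)
open import Relation.Nullary.Negation using (contradiction)
open import Relation.Binary.PropositionalEquality using (refl; sym; cong; subst₂)

private
  variable
    a b l : List ℕ
    m x y d : ℕ

head₀ : List ℕ → ℕ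
head₀ []      = 0
head₀ (x ∷ _) = x

prefixSum : ℕ → List ℕ → ℕ
prefixSum i xs = sum (take i xs)

infix 4 _≼_
_≼_ : List ℕ → List ℕ → Set
b ≼ a = ∀ i → prefixSum i b ≤ prefixSum i a

<⇒≡+suc : m < x → ∃ λ d → x ≡ m + suc d
<⇒≡+suc {m} m<x with m≤n⇒∃[o]m+o≡n m<x
... | d , refl = d , sym (+-suc m d)

*-assoc-mono-≤ : ∀ p q r s → p * q ≤ r * s → ∀ t → p * (q * t) ≤ r * (s * t)
*-assoc-mono-≤ p q r s pq≤rs t =
  subst₂ _≤_ (*-assoc p q t) (*-assoc r s t) (*-monoˡ-≤ t pq≤rs)

*-assoc-mono-< : ∀ p q r s → p * q < r * s → ∀ t .{{_ : NonZero t}} → p * (q * t) < r * (s * t)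
*-assoc-mono-< p q r s pq<rs t =
  subst₂ _<_ (*-assoc p q t) (*-assoc r s t) (*-monoˡ-< t pq<rs)

!-transfer-≤ : y ≤ m → ∀ d → m ! * (y + d) ! ≤ (m + d) ! * y !
!-transfer-≤ {y} {m} y≤m zero rewrite +-identityʳ y | +-identityʳ m = ≤-refl
!-transfer-≤ {y} {m} y≤m (suc d) rewrite +-suc y d | +-suc m d = begin
  m ! * (suc (y + d) * (y + d) !) ≡⟨ x*[y*z]≡y*[x*z] (m !) (suc (y + d)) ((y + d) !) ⟩
  suc (y + d) * (m ! * (y + d) !) ≤⟨ *-monoʳ-≤ (suc (y + d)) (!-transfer-≤ y≤m d) ⟩
  suc (y + d) * ((m + d) ! * y !) ≤⟨ *-monoˡ-≤ ((m + d) ! * y !) (s≤s (+-monoˡ-≤ d y≤m)) ⟩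
  suc (m + d) * ((m + d) ! * y !) ≡⟨ *-assoc (suc (m + d)) ((m + d) !) (y !) ⟨
  suc (m + d) ! * y !             ∎
  where open ≤-Reasoning

!-transfer-< : y < m → ∀ d → m ! * (y + suc d) ! < (m + suc d) ! * y !
!-transfer-< {y} {m} y<m d rewrite +-suc y d | +-suc m d = begin-strict
  m ! * (suc (y + d) * (y + d) !) ≡⟨ x*[y*z]≡y*[x*z] (m !) (suc (y + d)) ((y + d) !) ⟩
  suc (y + d) * (m ! * (y + d) !) ≤⟨ *-monoʳ-≤ (suc (y + d)) (!-transfer-≤ (<⇒≤ y<m) d) ⟩
  suc (y + d) * ((m + d) ! * y !) <⟨ *-monoˡ-< ((m + d) ! * y !) {{(m + d) !* y !≢0}} (s≤s (+-monoˡ-< d y<m)) ⟩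
  suc (m + d) * ((m + d) ! * y !) ≡⟨ *-assoc (suc (m + d)) ((m + d) !) (y !) ⟨
  suc (m + d) ! * y !             ∎
  where open ≤-Reasoning

1≤factProd : ∀ a → 1 ≤ factProd a
1≤factProd []      = ≤-refl
1≤factProd (x ∷ a) = *-mono-≤ (1≤n! x) (1≤factProd a)

factProd≢0 : ∀ a → NonZero (factProd a)
factProd≢0 a = >-nonZero (1≤factProd a)

1<factProd : ∀ a → 1 < head₀ a → 1 < factProd a
1<factProd []                ()
1<factProd (zero ∷ a)        ()
1<factProd (suc zero ∷ a)    (s≤s ())
1<factProd (suc (suc x) ∷ a) _ =
  *-mono-≤ {2} {_} {1} (*-mono-≤ {2} {suc (suc x)} {1} (s≤s (s≤s z≤n)) (1≤n! (suc x))) (1≤factProd a)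

prefixSum-[] : ∀ i → prefixSum i [] ≡ 0
prefixSum-[] i = cong sum (take-[] i)

prefixSum≤sum : ∀ i xs → prefixSum i xs ≤ sum xs
prefixSum≤sum zero    xs       = z≤n
prefixSum≤sum (suc i) []       = z≤n
prefixSum≤sum (suc i) (x ∷ xs) = +-monoʳ-≤ x (prefixSum≤sum i xs)

prefixSum≤*bound : All (m ≥_) b → ∀ i → prefixSum i b ≤ i * m
prefixSum≤*bound {b = []}    _          i       = ≤-trans (≤-reflexive (prefixSum-[] i)) z≤n
prefixSum≤*bound {b = _ ∷ _} _          zero    = z≤n
prefixSum≤*bound {b = _ ∷ _} (c≤m ∷ cs) (suc i) = +-mono-≤ c≤m (prefixSum≤*bound cs i)

≼-head : (m ∷ b) ≼ (x ∷ a) → m ≤ x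
≼-head {m} {x = x} h = subst₂ _≤_ (+-identityʳ m) (+-identityʳ x) (h 1)

≻⇒≼ : a ≻ b → b ≼ a
≻⇒≼ {a} {b} (_ , prefix , total) i with i ≤? length a
... | yes i≤∣a∣ = prefix i i≤∣a∣
... | no  i≰∣a∣ = begin
  prefixSum i b ≤⟨ prefixSum≤sum i b ⟩
  sum b         ≤⟨ total ⟩
  sum a         ≡⟨ cong sum (take-all i a (<⇒≤ (≰⇒> i≰∣a∣))) ⟨
  prefixSum i a ∎
  where open ≤-Reasoning

≻-tail : (x ∷ a) ≻ (x ∷ b) → a ≻ b
≻-tail {x} (s≤s ∣a∣≤∣b∣ , prefix , total) =
  ∣a∣≤∣b∣ , (λ i i≤∣a∣ → +-cancelˡ-≤ x _ _ (prefix (suc i) (s≤s i≤∣a∣))) , +-cancelˡ-≤ x _ _ total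

NonIncreasing-bound : NonIncreasing (m ∷ b) → All (m ≥_) b
NonIncreasing-bound lk = AllPairs.head (Linked⇒AllPairs (λ p q → ≤-trans q p) lk)

NonIncreasing-head₀ : NonIncreasing (m ∷ b) → head₀ b ≤ m
NonIncreasing-head₀ {b = []}    _  = z≤n
NonIncreasing-head₀ {b = _ ∷ _} lk = Linked.head lk

pour : ℕ → ℕ → List ℕ → List ℕ
pour m d []      = d ∷ []
pour m d (y ∷ l) with y ≤? m
... | yes _ = y + d ∷ l
... | no  _ = y ∷ pour m d l

pour-factProd : ∀ m d l → m ! * factProd (pour m d l) ≤ (m + d) ! * factProd l
pour-factProd m d [] = *-assoc-mono-≤ (m !) (d !) ((m + d) !) 1 (!-transfer-≤ {m = m} z≤n d) 1
pour-factProd m d (y ∷ l) with y ≤? m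
... | yes y≤m = *-assoc-mono-≤ (m !) ((y + d) !) ((m + d) !) (y !) (!-transfer-≤ y≤m d) (factProd l)
... | no  _   = begin
  m ! * (y ! * factProd (pour m d l)) ≡⟨ x*[y*z]≡y*[x*z] (m !) (y !) (factProd (pour m d l)) ⟩
  y ! * (m ! * factProd (pour m d l)) ≤⟨ *-monoʳ-≤ (y !) (pour-factProd m d l) ⟩
  y ! * ((m + d) ! * factProd l)      ≡⟨ x*[y*z]≡y*[x*z] (y !) ((m + d) !) (factProd l) ⟩
  (m + d) ! * (y ! * factProd l)      ∎
  where open ≤-Reasoning

-- When strictness fails, the excess landed on an entry equal to m or after entries above m.
pour-factProd-< : 0 < m → ∀ d l →
                  m ! * factProd (pour m (suc d) l) < (m + suc d) ! * factProd l
                  ⊎ m < head₀ (pour m (suc d) l)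
pour-factProd-< {m} 0<m d [] =
  inj₁ (*-assoc-mono-< (m !) (suc d !) ((m + suc d) !) 1 (!-transfer-< 0<m d) 1)
pour-factProd-< {m} 0<m d (y ∷ l) with y ≤? m
... | no  y≰m = inj₂ (≰⇒> y≰m)
... | yes y≤m with m≤n⇒m<n∨m≡n y≤m
...   | inj₁ y<m  = inj₁ (*-assoc-mono-< (m !) ((y + suc d) !) ((m + suc d) !) (y !)
                            (!-transfer-< y<m d) (factProd l) {{factProd≢0 l}})
...   | inj₂ refl = inj₂ (m<m+n m z<s)

pour-prefixSum : ∀ m d l i → d + prefixSum i l ≤ prefixSum i (pour m d l)
                             ⊎ i * m ≤ prefixSum i (pour m d l)
pour-prefixSum m d l       zero    = inj₂ z≤n
pour-prefixSum m d []      (suc i) = inj₁ (≤-reflexive (cong (d +_) (sym (prefixSum-[] i))))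
pour-prefixSum m d (y ∷ l) (suc i) with y ≤? m
... | yes _ = inj₁ (≤-reflexive (x+[y+z]≡[y+x]+z d y (prefixSum i l)))
... | no y≰m with pour-prefixSum m d l i
...   | inj₁ gained = inj₁ (≤-trans (≤-reflexive (x+[y+z]≡y+[x+z] d y (prefixSum i l))) (+-monoʳ-≤ y gained))
...   | inj₂ above  = inj₂ (+-mono-≤ (<⇒≤ (≰⇒> y≰m)) above)

pour-≼ : NonIncreasing (m ∷ b) → (m ∷ b) ≼ (m + d ∷ l) → b ≼ pour m d l
pour-≼ {m} {b} {d} {l} lk h i with pour-prefixSum m d l i
... | inj₁ gained = ≤-trans (+-cancelˡ-≤ m _ _ (≤-trans (h (suc i)) (≤-reflexive (+-assoc m d _)))) gained
... | inj₂ above  = ≤-trans (prefixSum≤*bound (NonIncreasing-bound lk) i) above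

mutual
  factProd-mono : ∀ a → NonIncreasing b → b ≼ a → factProd b ≤ factProd a
  factProd-mono {b} []      lk h = factProd-mono-∷ 0 [] lk λ i →
    ≤-trans (h i) (≤-trans (≤-reflexive (prefixSum-[] i)) z≤n)
  factProd-mono     (x ∷ l) lk h = factProd-mono-∷ x l lk h

  factProd-mono-∷ : ∀ x l → NonIncreasing b → b ≼ (x ∷ l) → factProd b ≤ factProd (x ∷ l)
  factProd-mono-∷ {[]}    x l _  _ = 1≤factProd (x ∷ l)
  factProd-mono-∷ {m ∷ b} x l lk h with m≤n⇒∃[o]m+o≡n (≼-head h)
  ... | d , refl = begin
    m ! * factProd b              ≤⟨ *-monoʳ-≤ (m !) (factProd-mono (pour m d l) (Linked.tail lk) (pour-≼ lk h)) ⟩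
    m ! * factProd (pour m d l)   ≤⟨ pour-factProd m d l ⟩
    (m + d) ! * factProd l        ∎
    where open ≤-Reasoning

factProd-mono-< : NonIncreasing b → Positive b → b ≼ a → 1 < head₀ a → head₀ b < head₀ a
                  → factProd b < factProd a
factProd-mono-< {[]}    {a}     _  _          _ 1<x _   = 1<factProd a 1<x
factProd-mono-< {m ∷ b} {x ∷ l} lk (0<m ∷ pos) h _ m<x with <⇒≡+suc m<x
... | d , refl with pour-factProd-< 0<m d l
...   | inj₁ shrinks = begin-strict
  m ! * factProd b                     ≤⟨ *-monoʳ-≤ (m !) (factProd-mono _ (Linked.tail lk) (pour-≼ lk h)) ⟩
  m ! * factProd (pour m (suc d) l)    <⟨ shrinks ⟩
  (m + suc d) ! * factProd l           ∎
  where open ≤-Reasoning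
...   | inj₂ m<head = begin-strict
  m ! * factProd b                     <⟨ *-monoʳ-< (m !) {{m !≢0}} b<pour ⟩
  m ! * factProd (pour m (suc d) l)    ≤⟨ pour-factProd m (suc d) l ⟩
  (m + suc d) ! * factProd l           ∎
  where
  open ≤-Reasoning
  b<pour : factProd b < factProd (pour m (suc d) l)
  b<pour = factProd-mono-< (Linked.tail lk) pos (pour-≼ lk h) (≤-<-trans 0<m m<head)
             (≤-<-trans (NonIncreasing-head₀ lk) m<head)

factProd-injective : NonIncreasing b → Positive b → a ≻ b → factProd a ≡ factProd b → a ≡ b
factProd-injective {[]}    {[]}    _ _ _ _ = refl
factProd-injective {m ∷ b} {[]}    _ (0<m ∷ _) (_ , _ , total) _ =
  contradiction (≤-trans 0<m (≤-trans (m≤m+n m (sum b)) total)) λ ()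
factProd-injective {[]}    {x ∷ a} _ _ (() , _) _
factProd-injective {m ∷ b} {x ∷ a} lk (0<m ∷ pos) a≻b eq with m≤n⇒m<n∨m≡n (≼-head (≻⇒≼ a≻b))
... | inj₁ m<x  = contradiction (sym eq)
                    (<⇒≢ (factProd-mono-< lk (0<m ∷ pos) (≻⇒≼ a≻b) (≤-<-trans 0<m m<x) m<x))
... | inj₂ refl = cong (m ∷_) (factProd-injective (Linked.tail lk) pos (≻-tail a≻b)
                                 (*-cancelˡ-≡ (factProd a) (factProd b) (m !) {{m !≢0}} eq))

theorem2p1 : (a b : List ℕ) → NonIncreasing a → NonIncreasing b
    → Positive a → Positive b → a ≻ b
    → (factProd a ≥ factProd b) × ((factProd a ≡ factProd b) ⇔ (a ≡ b))
theorem2p1 a b _ lkB _ posB a≻b =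
  factProd-mono a lkB (≻⇒≼ a≻b) , mk⇔ (factProd-injective lkB posB a≻b) (cong factProd)
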